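{- Let $Q$ be a dense set of quartets on a finite set $X$. Then every vector in $U(Q)$ is cyclic, and $$U(Q)=\{u\in\mathrm{GF}(2)^{X^3} : u(x,y,z)=0 \text{ whenever } x,y,z \text{ are not pairwise distinct};\ u(a,b,c)=u(b,c,a)=u(a,c,b)+1 \text{ for all pairwise distinct } a,b,c\in X;\ u(a,b,c)=u(a,b,d) \text{ and } u(a,c,d)=u(b,c,d) \text{ for all } (ab|cd)\in Q\}.$$
   Context: A cyclic ordering of $X$ is an equivalence class of linear orderings of $X$ modulo rotation; $C\succeq[y_1,\dots,y_k]$ means $[y_1,\dots,y_k]$ arises from $C$ by omitting entries. For a cyclic ordering $C$ of $X$, $u^C\in\mathrm{GF}(2)^{X^3}$ has $u^C(x,y,z)=1$ iff $x,y,z$ are distinct and $C\succeq[x,y,z]$; $u\in\mathrm{GF}(2)^{X^3}$ is cyclic if $u=u^C$ for some cyclic ordering $C$ of $X$. $\mathcal{U}=\mathcal{U}^X$ is the affine subspace of all $u\in\mathrm{GF}(2)^{X^3}$ such that: $u(x,x,y)=0$ for all $x,y$; $u(x,y,z)+u(y,z,x)=0$ for all $x,y,z$; $u(x,y,z)+u(y,x,z)=1$ for all pairwise distinct $x,y,z$; and $u(t,x,y)+u(t,x,z)+u(t,y,z)+u(x,y,z)=0$ for all pairwise distinct $t,x,y,z$. For distinct $a,b,c,d\in X$, the quartet $(ab|cd)$ is $\{\{a,b\},\{c,d\}\}$ with underlying set $\{a,b,c,d\}$. For a set $Q$ of quartets on $X$, $U(Q):=\{u\in\mathcal{U}: u(a,b,c)+u(a,b,d)=0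 \text{ for all }(ab|cd)\in Q\}$. $Q$ is dense if every 4-element subset of $X$ is the underlying set of some quartet in $Q$. -}

module Defs where

open import Data.Nat using (ℕ)
open import Data.Fin using (Fin)
open import Data.Bool using (Bool; true; false; _xor_)
open import Data.List using (List; []; _∷_; _++_; drop; take; allFin)
open import Data.List.Relation.Unary.Any using (Any)
open import Data.List.Relation.Binary.Permutation.Propositional using (_↭_)
open import Data.List.Relation.Binary.Sublist.Propositional using (_⊆_)
open import Data.Product using (Σ; ∃; _×_; _,_)
open import Relation.Nullary using (¬_)
open import Data.Bool using (not)
open import Data.Sum using (_⊎_)
open import Relation.Binary.PropositionalEquality using (_≡_; _≢_)
open import Function.Bundles using (_⇔_)

-- The finite set X is Fin n.  GF(2) is Bool (false = 0, true = 1, + = xor).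

Vec3 : ℕ → Set
Vec3 n = Fin n → Fin n → Fin n → Bool

Distinct3 : ∀ {n} → Fin n → Fin n → Fin n → Set
Distinct3 x y z = x ≢ y × y ≢ z × x ≢ z

Distinct4 : ∀ {n} → Fin n → Fin n → Fin n → Fin n → Set
Distinct4 a b c d = a ≢ b × a ≢ c × a ≢ d × b ≢ c × b ≢ d × c ≢ d

LinearOrdering : ℕ → Set
LinearOrdering n = Σ (List (Fin n)) (λ L → L ↭ allFin n)

rotate : ∀ {A : Set} → ℕ → List A → List A
rotate r L = drop r L ++ take r L

-- A cyclic ordering C is the class of a linear ordering L modulo rotation;
-- C ⪰ [x,y,z] iff some rotation of L has [x,y,z] as a sublist.
-- (This only depends on the rotation class of L.)
_⪰[_,_,_] : ∀ {n} → LinearOrdering n → Fin n → Fin n → Fin n → Set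
(L , _) ⪰[ x , y , z ] = ∃ λ r → (x ∷ y ∷ z ∷ []) ⊆ rotate r L

IsUC : ∀ {n} → LinearOrdering n → Vec3 n → Set
IsUC C u = ∀ x y z → (u x y z ≡ true) ⇔ (Distinct3 x y z × C ⪰[ x , y , z ])

Cyclic : ∀ {n} → Vec3 n → Set
Cyclic {n} u = Σ (LinearOrdering n) (λ C → IsUC C u)

In𝒰 : ∀ {n} → Vec3 n → Set
In𝒰 u =
    (∀ x y → u x x y ≡ false)
  × (∀ x y z → u x y z xor u y z x ≡ false)
  × (∀ x y z → Distinct3 x y z → u x y z xor u y x z ≡ true)
  × (∀ t x y z → Distinct4 t x y z →
       (u t x y xor u t x z xor u t y z xor u x y z) ≡ false)

-- A quartet (ab|cd), given by a labelling a,b,c,d of pairwise distinct elements.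
record Quartet (n : ℕ) : Set where
  constructor _∣∣_
  field
    qa qb qc qd : Fin n
    distinct : Distinct4 qa qb qc qd

SamePair : ∀ {n} → Fin n → Fin n → Fin n → Fin n → Set
SamePair a b p q = (a ≡ p × b ≡ q) ⊎ (a ≡ q × b ≡ p)

Denotes : ∀ {n} → Quartet n → Fin n → Fin n → Fin n → Fin n → Set
Denotes q a b c d =
    (SamePair a b qa qb × SamePair c d qc qd)
  ⊎ (SamePair a b qc qd × SamePair c d qa qb)
  where open Quartet q

_∈Q_ : ∀ {n} → (Fin n × Fin n × Fin n × Fin n) → List (Quartet n) → Set
(a , b , c , d) ∈Q Q = Distinct4 a b c d × Any (λ q → Denotes q a b c d) Q

_∈4_ : ∀ {n} → Fin n → (Fin n × Fin n × Fin n × Fin n) → Set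
e ∈4 (w , x , y , z) = e ≡ w ⊎ e ≡ x ⊎ e ≡ y ⊎ e ≡ z

UnderlyingIs : ∀ {n} → Quartet n → (Fin n × Fin n × Fin n × Fin n) → Set
UnderlyingIs q S = ∀ e → (e ∈4 (qa , qb , qc , qd)) ⇔ (e ∈4 S)
  where open Quartet q

Dense : ∀ {n} → List (Quartet n) → Set
Dense Q = ∀ w x y z → Distinct4 w x y z → Any (λ q → UnderlyingIs q (w , x , y , z)) Q

InU : ∀ {n} → List (Quartet n) → Vec3 n → Set
InU Q u = In𝒰 u × (∀ a b c d → (a , b , c , d) ∈Q Q → u a b c xor u a b d ≡ false)

InRHS : ∀ {n} → List (Quartet n) → Vec3 n → Set
InRHS Q u =
    (∀ x y z → ¬ Distinct3 x y z → u x y z ≡ false)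
  × (∀ a b c → Distinct3 a b c → u a b c ≡ u b c a × u b c a ≡ not (u a c b))
  × (∀ a b c d → (a , b , c , d) ∈Q Q → u a b c ≡ u a b d × u a c d ≡ u b c d)

-- A vector u of U(Q) is alternating and satisfies the four-term
-- cocycle relation; for a quartet (ab|cd) of Q the cocycle relation turns
-- u(a,b,c) = u(a,b,d) into u(a,c,d) = u(b,c,d), so u "displays" (ab|cd).
-- Displaying some quartet on {a,b,c,d} is invariant under relabelling, hence by
-- density u displays a quartet on every 4-set, and this forces each relation
-- u(t,·,·) to be transitive.  Cutting the cyclic order open at the point 0 gives
-- a strict linear order ≺, and the cocycle relation at t = 0 reads
-- u(a,b,c) = [a≺b] + [a≺c] + [b≺c], which is 1 exactly when a, b, c appear in
-- cyclic order in the ≺-sorted enumeration of X.  Conversely, the explicit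
-- conditions make u alternating and display every quartet of Q, and displaying
-- a quartet on each 4-set yields the cocycle relation, so u ∈ U(Q).

module Submission where

open import Defs
open import Data.Nat using (ℕ; zero; suc)
open import Data.Fin using (Fin; zero; suc)
open import Data.Fin.Properties using (_≟_)
open import Data.Bool using (Bool; true; false; _xor_; not)
open import Data.Bool.Properties
  using (xor-same; xor-inverseʳ; xor-assoc; xor-comm; xor-identityʳ; not-injective; not-involutive)
open import Data.List using (List; []; _∷_; _++_; [_]; drop; take; length; allFin)
open import Data.List.Properties using (++-assoc; take++drop≡id)
open import Data.List.Relation.Unary.Any using (here; there)
open import Data.List.Relation.Unary.All as All using (All; []; _∷_)
open import Data.List.Relation.Unary.AllPairs as AllPairs using (AllPairs; []; _∷_)
open import Data.List.Relation.Unary.Unique.Propositional using (Unique)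
open import Data.List.Relation.Unary.Unique.Propositional.Properties using (allFin⁺)
open import Data.List.Relation.Unary.Sorted.TotalOrder.Properties using (Sorted⇒AllPairs)
open import Data.List.Membership.Propositional using (_∈_; find; lose)
open import Data.List.Membership.Propositional.Properties using (∈-allFin; ∈-∃++; ∈-++⁻)
open import Data.List.Membership.Propositional.Properties.WithK using (unique∧set⇒bag)
open import Data.List.Relation.Binary.BagAndSetEquality using (∼bag⇒↭)
open import Data.List.Relation.Binary.Permutation.Propositional
  using (_↭_; refl; prep; swap; trans; ↭-sym; ↭⇒↭ₛ)
open import Data.List.Relation.Binary.Permutation.Propositional.Properties using (∈-resp-↭)
open import Data.List.Relation.Binary.Permutation.Setoid.Properties using (Unique-resp-↭)
open import Data.List.Relation.Binary.Sublist.Propositional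
  using (_⊆_; []; _∷_; _∷ʳ_; minimum; ⊆-refl; from∈)
open import Data.List.Relation.Binary.Sublist.Propositional.Properties
  using (++⁺; ++⁺ˡ; ++⁺ʳ; All-resp-⊆)
import Data.List.Sort as Sort
open import Data.Product using (∃; ∃₂; _×_; _,_; proj₁)
open import Data.Sum using (_⊎_; inj₁; inj₂)
open import Data.Empty using (⊥-elim)
open import Relation.Nullary using (¬_; Dec; yes; no; ¬?; _×-dec_)
open import Relation.Binary.Bundles using (StrictTotalOrder)
open import Relation.Binary.Definitions using (DecidableEquality; Trichotomous; tri<; tri≈; tri>)
import Relation.Binary.Properties.StrictTotalOrder as StrictTotalOrderProperties
open import Relation.Binary.PropositionalEquality
  using (_≡_; _≢_; refl; sym; cong; cong₂; subst; ≢-sym; setoid; isEquivalence; resp₂;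
         module ≡-Reasoning)
  renaming (trans to ≡-trans)
open import Function.Bundles using (_⇔_; mk⇔; Equivalence)
open import Function.Construct.Composition using (_⇔-∘_)
open import Function.Construct.Symmetry using (⇔-sym)

-- Permutations, sublists and rotations of lists

module _ {A : Set} {P : List A → Set}
  (swap-resp : ∀ ws {x y vs} → P (ws ++ x ∷ y ∷ vs) → P (ws ++ y ∷ x ∷ vs)) where

  resp-↭ : ∀ ws {xs ys} → xs ↭ ys → P (ws ++ xs) → P (ws ++ ys)
  resp-↭ ws refl h = h
  resp-↭ ws {x ∷ xs} {x ∷ ys} (prep x p) h =
    subst P (++-assoc ws [ x ] ys) (resp-↭ (ws ++ [ x ]) p (subst P (sym (++-assoc ws [ x ] xs)) h))
  resp-↭ ws {x ∷ y ∷ xs} {y ∷ x ∷ ys} (swap x y p) h =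
    subst P (++-assoc ws (y ∷ x ∷ []) ys)
      (resp-↭ (ws ++ y ∷ x ∷ []) p (subst P (sym (++-assoc ws (y ∷ x ∷ []) xs)) (swap-resp ws h)))
  resp-↭ ws (trans p q) h = resp-↭ ws q (resp-↭ ws p h)

module _ {A : Set} where

  AllPairs-resp-⊇ : ∀ {R : A → A → Set} {xs ys} → xs ⊆ ys → AllPairs R ys → AllPairs R xs
  AllPairs-resp-⊇ [] [] = []
  AllPairs-resp-⊇ (_ ∷ʳ τ) (_ ∷ rs) = AllPairs-resp-⊇ τ rs
  AllPairs-resp-⊇ (refl ∷ τ) (r ∷ rs) = All-resp-⊆ τ r ∷ AllPairs-resp-⊇ τ rs

  ⊆-++-split : ∀ ys zs {xs : List A} → xs ⊆ ys ++ zs →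
    ∃₂ λ xs₁ xs₂ → xs ≡ xs₁ ++ xs₂ × xs₁ ⊆ ys × xs₂ ⊆ zs
  ⊆-++-split [] zs τ = [] , _ , refl , [] , τ
  ⊆-++-split (y ∷ ys) zs (.y ∷ʳ τ) with ⊆-++-split ys zs τ
  ... | xs₁ , xs₂ , refl , τ₁ , τ₂ = xs₁ , xs₂ , refl , y ∷ʳ τ₁ , τ₂
  ⊆-++-split (y ∷ ys) zs (refl ∷ τ) with ⊆-++-split ys zs τ
  ... | xs₁ , xs₂ , refl , τ₁ , τ₂ = y ∷ xs₁ , xs₂ , refl , refl ∷ τ₁ , τ₂

  rotate-length-++ : ∀ (xs ys : List A) → rotate (length xs) (xs ++ ys) ≡ ys ++ xs
  rotate-length-++ xs ys = cong₂ _++_ (drop-length xs) (take-length xs)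
    where
    drop-length : ∀ xs → drop (length xs) (xs ++ ys) ≡ ys
    drop-length [] = refl
    drop-length (_ ∷ xs) = drop-length xs
    take-length : ∀ xs → take (length xs) (xs ++ ys) ≡ xs
    take-length [] = refl
    take-length (x ∷ xs) = cong (x ∷_) (take-length xs)

Cyclically : ∀ {A : Set} → (A → A → Set) → A → A → A → Set
Cyclically _<_ x y z = (x < y × y < z) ⊎ (y < z × z < x) ⊎ (z < x × x < y)

module _ {A : Set} {_<_ : A → A → Set} where

  rotation⊇⇒cyclically : ∀ {L : List A} r {x y z} → AllPairs _<_ L →
    (x ∷ y ∷ z ∷ []) ⊆ rotate r L → Cyclically _<_ x y z
  rotation⊇⇒cyclically {L} r sorted τ with ⊆-++-split (drop r L) (take r L) τ
  ... | xs₁ , xs₂ , eq , τ₁ , τ₂ = cases xs₁ xs₂ eq (AllPairs-resp-⊇ (++⁺ τ₂ τ₁)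
          (subst (AllPairs _<_) (sym (take++drop≡id r L)) sorted))
    where
    cases : ∀ {x y z} xs₁ xs₂ → x ∷ y ∷ z ∷ [] ≡ xs₁ ++ xs₂ → AllPairs _<_ (xs₂ ++ xs₁) →
      Cyclically _<_ x y z
    cases [] _ refl ((x<y ∷ _) ∷ (y<z ∷ _) ∷ _) = inj₁ (x<y , y<z)
    cases (_ ∷ []) _ refl ((y<z ∷ _) ∷ (z<x ∷ _) ∷ _) = inj₂ (inj₁ (y<z , z<x))
    cases (_ ∷ _ ∷ []) _ refl ((z<x ∷ _) ∷ (x<y ∷ _) ∷ _) = inj₂ (inj₂ (z<x , x<y))
    cases (_ ∷ _ ∷ _ ∷ []) [] refl ((x<y ∷ _) ∷ (y<z ∷ _) ∷ _) = inj₁ (x<y , y<z)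
    cases (_ ∷ _ ∷ _ ∷ _ ∷ _) _ ()

  module StrictlySorted (<-irrefl : ∀ {x} → ¬ x < x) (<-trans : ∀ {x y z} → x < y → y < z → x < z) where

    private
      ∈-tail : ∀ {w z ys} → w < z → z ∈ w ∷ ys → z ∈ ys
      ∈-tail w<w (here refl) = ⊥-elim (<-irrefl w<w)
      ∈-tail _ (there z∈ys) = z∈ys

    sorted-⊆ : ∀ {xs ys} → AllPairs _<_ ys → AllPairs _<_ xs → All (_∈ ys) xs → xs ⊆ ys
    sorted-⊆ {ys = ys} _ [] [] = minimum ys
    sorted-⊆ {ys = w ∷ _} (_ ∷ sorted-ys) (x<xs ∷ sorted-xs) (here refl ∷ xs∈) =
      refl ∷ sorted-⊆ sorted-ys sorted-xs (All.zipWith (λ (x<z , z∈) → ∈-tail x<z z∈) (x<xs , xs∈))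
    sorted-⊆ {ys = w ∷ _} (w<ys ∷ sorted-ys) (x<xs ∷ sorted-xs) (there x∈ys ∷ xs∈) =
      w ∷ʳ sorted-⊆ sorted-ys (x<xs ∷ sorted-xs)
        (x∈ys ∷ All.zipWith (λ (x<z , z∈) → ∈-tail (<-trans (All.lookup w<ys x∈ys) x<z) z∈)
                            (x<xs , xs∈))

    module _ {xs ys : List A} {x : A} (sorted : AllPairs _<_ (xs ++ x ∷ ys)) where

      private
        precedes : ∀ {a b} → (a ∷ b ∷ []) ⊆ xs ++ x ∷ ys → a < b
        precedes τ with (a<b ∷ []) ∷ _ ← AllPairs-resp-⊇ τ sorted = a<b

      below⇒∈ˡ : ∀ {y} → y < x → y ∈ xs ++ x ∷ ys → y ∈ xs
      below⇒∈ˡ y<x y∈ with ∈-++⁻ xs y∈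
      ... | inj₁ y∈xs = y∈xs
      ... | inj₂ (here refl) = ⊥-elim (<-irrefl y<x)
      ... | inj₂ (there y∈ys) = ⊥-elim (<-irrefl (<-trans y<x (precedes (++⁺ˡ xs (refl ∷ from∈ y∈ys)))))

      above⇒∈ʳ : ∀ {y} → x < y → y ∈ xs ++ x ∷ ys → y ∈ ys
      above⇒∈ʳ x<y y∈ with ∈-++⁻ xs y∈
      ... | inj₁ y∈xs = ⊥-elim (<-irrefl (<-trans x<y (precedes (++⁺ (from∈ y∈xs) (refl ∷ minimum ys)))))
      ... | inj₂ (here refl) = ⊥-elim (<-irrefl x<y)
      ... | inj₂ (there y∈ys) = y∈ys

    cyclically⇒rotation⊇ : ∀ {L x y z} → AllPairs _<_ L → x ∈ L → y ∈ L → z ∈ L →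
      Cyclically _<_ x y z → ∃ λ r → (x ∷ y ∷ z ∷ []) ⊆ rotate r L
    cyclically⇒rotation⊇ {x = x} {y} {z} sorted x∈L y∈L z∈L cyc with ∈-∃++ x∈L
    ... | xs , ys , refl = length xs
      , subst ((x ∷ y ∷ z ∷ []) ⊆_) (sym (rotate-length-++ xs (x ∷ ys))) (refl ∷ after-x cyc)
      where
      sorted-xs : AllPairs _<_ xs
      sorted-xs = AllPairs-resp-⊇ (++⁺ʳ (x ∷ ys) ⊆-refl) sorted
      sorted-ys : AllPairs _<_ ys
      sorted-ys = AllPairs-resp-⊇ (++⁺ˡ xs (x ∷ʳ ⊆-refl)) sorted
      after-x : Cyclically _<_ x y z → (y ∷ z ∷ []) ⊆ ys ++ xs
      after-x (inj₁ (x<y , y<z)) = ++⁺ʳ xs (sorted-⊆ sorted-ys ((y<z ∷ []) ∷ [] ∷ [])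
        (above⇒∈ʳ sorted x<y y∈L ∷ above⇒∈ʳ sorted (<-trans x<y y<z) z∈L ∷ []))
      after-x (inj₂ (inj₁ (y<z , z<x))) = ++⁺ˡ ys (sorted-⊆ sorted-xs ((y<z ∷ []) ∷ [] ∷ [])
        (below⇒∈ˡ sorted (<-trans y<z z<x) y∈L ∷ below⇒∈ˡ sorted z<x z∈L ∷ []))
      after-x (inj₂ (inj₂ (z<x , x<y))) =
        ++⁺ (from∈ (above⇒∈ʳ sorted x<y y∈L)) (from∈ (below⇒∈ˡ sorted z<x z∈L))

-- Strict total orders given by a Boolean relation

module BoolOrder {A : Set} (_≟_ : DecidableEquality A) (_≺_ : A → A → Bool)
  (≺-irrefl : ∀ a → a ≺ a ≡ false)
  (≺-flip : ∀ {a b} → a ≢ b → b ≺ a ≡ not (a ≺ b))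
  (≺-trans : ∀ {a b c} → a ≺ b ≡ true → b ≺ c ≡ true → a ≺ c ≡ true) where

  _<_ : A → A → Set
  a < b = a ≺ b ≡ true

  orientation : A → A → A → Bool
  orientation a b c = a ≺ b xor a ≺ c xor b ≺ c

  orientation≡true⇔cyclically : ∀ {a b c} → a ≢ b → a ≢ c →
    orientation a b c ≡ true ⇔ Cyclically _<_ a b c
  orientation≡true⇔cyclically {a} {b} {c} a≢b a≢c rewrite ≺-flip a≢c
    with a ≺ b in ab | a ≺ c in ac | b ≺ c in bc
  ... | true | true | true = mk⇔ (λ _ → inj₁ (refl , refl)) (λ _ → refl)
  ... | true | true | false =
    mk⇔ (λ ()) λ { (inj₁ (_ , ())) ; (inj₂ (inj₁ (() , _))) ; (inj₂ (inj₂ (() , _))) }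
  ... | true | false | true with () ← ≡-trans (sym (≺-trans ab bc)) ac
  ... | true | false | false = mk⇔ (λ _ → inj₂ (inj₂ (refl , refl))) (λ _ → refl)
  ... | false | true | true =
    mk⇔ (λ ()) λ { (inj₁ (() , _)) ; (inj₂ (inj₁ (_ , ()))) ; (inj₂ (inj₂ (() , _))) }
  ... | false | true | false with () ← ≡-trans (sym (≺-trans (≡-trans (≺-flip a≢b) (cong not ab)) ac)) bc
  ... | false | false | true = mk⇔ (λ _ → inj₂ (inj₁ (refl , refl))) (λ _ → refl)
  ... | false | false | false =
    mk⇔ (λ ()) λ { (inj₁ (() , _)) ; (inj₂ (inj₁ (() , _))) ; (inj₂ (inj₂ (_ , ()))) }

  <-irrefl : ∀ {a} → ¬ a < a
  <-irrefl {a} a<a with () ← ≡-trans (sym (≺-irrefl a)) a<a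

  private
    <-compare : Trichotomous _≡_ _<_
    <-compare a b with a ≟ b
    ... | yes refl = tri≈ <-irrefl refl <-irrefl
    ... | no a≢b with a ≺ b in ab
    ... | true = tri< refl a≢b λ b<a → <-irrefl (≺-trans ab b<a)
    ... | false = tri> (λ ()) a≢b (≡-trans (≺-flip a≢b) (cong not ab))

  <-strictTotalOrder : StrictTotalOrder _ _ _
  <-strictTotalOrder = record
    { isStrictTotalOrder = record
      { isStrictPartialOrder = record
        { isEquivalence = isEquivalence
        ; irrefl = λ { refl → <-irrefl }
        ; trans = ≺-trans
        ; <-resp-≈ = resp₂ _<_
        }
      ; compare = <-compare
      }
    }

  open StrictTotalOrderProperties <-strictTotalOrder using (decTotalOrder; totalOrder)
  open Sort decTotalOrder using (sort-↗)

  open Sort decTotalOrder public using (sort; sort-↭)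

  sort-strictlySorted : ∀ {xs} → Unique xs → AllPairs _<_ (sort xs)
  sort-strictlySorted {xs} xs! = AllPairs.zipWith strict
    ( Sorted⇒AllPairs totalOrder (sort-↗ xs)
    , Unique-resp-↭ (setoid A) (↭⇒↭ₛ (↭-sym (sort-↭ xs))) xs!)
    where
    strict : ∀ {a b} → (a < b ⊎ a ≡ b) × a ≢ b → a < b
    strict (inj₁ a<b , _) = a<b
    strict (inj₂ a≡b , a≢b) = ⊥-elim (a≢b a≡b)

-- Symmetric predicates and dense sets of quartets

module _ {n : ℕ} where

  Distinct4-swap₁₂ : ∀ {a b c d : Fin n} → Distinct4 a b c d → Distinct4 b a c d
  Distinct4-swap₁₂ (ab , ac , ad , bc , bd , cd) = ≢-sym ab , bc , bd , ac , ad , cd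

  Distinct4-swap₂₃ : ∀ {a b c d : Fin n} → Distinct4 a b c d → Distinct4 a c b d
  Distinct4-swap₂₃ (ab , ac , ad , bc , bd , cd) = ac , ab , ad , ≢-sym bc , cd , bd

  Distinct4-swap₃₄ : ∀ {a b c d : Fin n} → Distinct4 a b c d → Distinct4 a b d c
  Distinct4-swap₃₄ (ab , ac , ad , bc , bd , cd) = ab , ad , ac , bd , bc , ≢-sym cd

  Distinct4⇒Unique : ∀ {a b c d : Fin n} → Distinct4 a b c d → Unique (a ∷ b ∷ c ∷ d ∷ [])
  Distinct4⇒Unique (ab , ac , ad , bc , bd , cd) =
    (ab ∷ ac ∷ ad ∷ []) ∷ (bc ∷ bd ∷ []) ∷ (cd ∷ []) ∷ [] ∷ []

  record Symmetric4 (P : Fin n → Fin n → Fin n → Fin n → Set) : Set where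
    field
      swap₁₂ : ∀ {a b c d} → Distinct4 a b c d → P a b c d → P b a c d
      swap₂₃ : ∀ {a b c d} → Distinct4 a b c d → P a b c d → P a c b d
      swap₃₄ : ∀ {a b c d} → Distinct4 a b c d → P a b c d → P a b d c

    private
      data Lift : List (Fin n) → Set where
        lift : ∀ {a b c d} → Distinct4 a b c d → P a b c d → Lift (a ∷ b ∷ c ∷ d ∷ [])

      -- Lift holds only of lists of length 4, so only the three inner swaps can occur.
      swap-Lift : ∀ ws {x y vs} → Lift (ws ++ x ∷ y ∷ vs) → Lift (ws ++ y ∷ x ∷ vs)
      swap-Lift [] {vs = _ ∷ _ ∷ []} (lift D p) = lift (Distinct4-swap₁₂ D) (swap₁₂ D p)
      swap-Lift (_ ∷ []) {vs = _ ∷ []} (lift D p) = lift (Distinct4-swap₂₃ D) (swap₂₃ D p)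
      swap-Lift (_ ∷ _ ∷ []) {vs = []} (lift D p) = lift (Distinct4-swap₃₄ D) (swap₃₄ D p)
      swap-Lift [] {vs = []} ()
      swap-Lift [] {vs = _ ∷ []} ()
      swap-Lift [] {vs = _ ∷ _ ∷ _ ∷ _} ()
      swap-Lift (_ ∷ []) {vs = []} ()
      swap-Lift (_ ∷ []) {vs = _ ∷ _ ∷ _} ()
      swap-Lift (_ ∷ _ ∷ []) {vs = _ ∷ _} ()
      swap-Lift (_ ∷ _ ∷ _ ∷ []) ()
      swap-Lift (_ ∷ _ ∷ _ ∷ _ ∷ []) ()
      swap-Lift (_ ∷ _ ∷ _ ∷ _ ∷ _ ∷ _) ()

    permute : ∀ {a b c d t x y z} → Distinct4 a b c d →
      (a ∷ b ∷ c ∷ d ∷ []) ↭ (t ∷ x ∷ y ∷ z ∷ []) → P a b c d → P t x y z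
    permute D σ p with resp-↭ {P = Lift} swap-Lift [] σ (lift D p)
    ... | lift _ q = q

module _ {n : ℕ} {Q : List (Quartet n)} where

  private
    ∈4⇔∈ : ∀ {e a b c d : Fin n} → e ∈4 (a , b , c , d) ⇔ e ∈ (a ∷ b ∷ c ∷ d ∷ [])
    ∈4⇔∈ = mk⇔ to from
      where
      to : ∀ {e a b c d} → e ∈4 (a , b , c , d) → e ∈ (a ∷ b ∷ c ∷ d ∷ [])
      to (inj₁ p) = here p
      to (inj₂ (inj₁ p)) = there (here p)
      to (inj₂ (inj₂ (inj₁ p))) = there (there (here p))
      to (inj₂ (inj₂ (inj₂ p))) = there (there (there (here p)))
      from : ∀ {e a b c d} → e ∈ (a ∷ b ∷ c ∷ d ∷ []) → e ∈4 (a , b , c , d)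
      from (here p) = inj₁ p
      from (there (here p)) = inj₂ (inj₁ p)
      from (there (there (here p))) = inj₂ (inj₂ (inj₁ p))
      from (there (there (there (here p)))) = inj₂ (inj₂ (inj₂ p))

  dense⇒quartet-on : Dense Q → ∀ {t x y z} → Distinct4 t x y z →
    ∃ λ ((a , b , c , d) : Fin n × Fin n × Fin n × Fin n) →
      (a , b , c , d) ∈Q Q × (a ∷ b ∷ c ∷ d ∷ []) ↭ (t ∷ x ∷ y ∷ z ∷ [])
  dense⇒quartet-on dense {t} {x} {y} {z} D with find (dense t x y z D)
  ... | q , q∈Q , same-set = _ , (distinct , lose q∈Q self) , ∼bag⇒↭ (unique∧set⇒bag
        (Distinct4⇒Unique distinct) (Distinct4⇒Unique D)
        (λ {e} → ∈4⇔∈ ⇔-∘ (same-set e ⇔-∘ ⇔-sym ∈4⇔∈)))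
    where
    open Quartet q
    self : Denotes q qa qb qc qd
    self = inj₁ (inj₁ (refl , refl) , inj₁ (refl , refl))

  dense⇒everywhere : Dense Q → ∀ {P} → Symmetric4 P →
    (∀ {a b c d} → (a , b , c , d) ∈Q Q → P a b c d) →
    ∀ {t x y z} → Distinct4 t x y z → P t x y z
  dense⇒everywhere dense sym on-Q D with dense⇒quartet-on dense D
  ... | _ , q∈Q , σ = Symmetric4.permute sym (proj₁ q∈Q) σ (on-Q q∈Q)

-- Alternating cocycles and displayed quartets

xor≡false⇒≡ : ∀ {a b} → a xor b ≡ false → a ≡ b
xor≡false⇒≡ {true} {true} _ = refl
xor≡false⇒≡ {false} {false} _ = refl

≡⇒xor≡false : ∀ {a b} → a ≡ b → a xor b ≡ false
≡⇒xor≡false {a} refl = xor-same a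

xor≡true⇒≡not : ∀ {a b} → a xor b ≡ true → b ≡ not a
xor≡true⇒≡not {true} {false} _ = refl
xor≡true⇒≡not {false} {true} _ = refl

xor-cancelˡ : ∀ a b → a xor a xor b ≡ b
xor-cancelˡ a b = ≡-trans (sym (xor-assoc a a b)) (cong (_xor b) (xor-same a))

xor-aabb : ∀ a b → a xor a xor b xor b ≡ false
xor-aabb a b = ≡-trans (xor-cancelˡ a (b xor b)) (xor-same b)

xor-abba : ∀ a b → a xor b xor b xor a ≡ false
xor-abba true true = refl
xor-abba true false = refl
xor-abba false true = refl
xor-abba false false = refl

xor-not-crossed : ∀ a b → not a xor b xor a xor not b ≡ false
xor-not-crossed true true = refl
xor-not-crossed true false = refl
xor-not-crossed false true = refl
xor-not-crossed false false = refl

xor₄≡false⇒≡ : ∀ a b c {d} → a xor b xor c xor d ≡ false → a xor b xor c ≡ d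
xor₄≡false⇒≡ a b c {d} sum≡false = xor≡false⇒≡ (begin
  (a xor b xor c) xor d    ≡⟨ xor-assoc a (b xor c) d ⟩
  a xor (b xor c) xor d    ≡⟨ cong (a xor_) (xor-assoc b c d) ⟩
  a xor b xor c xor d      ≡⟨ sum≡false ⟩
  false                    ∎)
  where open ≡-Reasoning

distinct3? : ∀ {n} (x y z : Fin n) → Dec (Distinct3 x y z)
distinct3? x y z = ¬? (x ≟ y) ×-dec ¬? (y ≟ z) ×-dec ¬? (x ≟ z)

module _ {n : ℕ} where

  record Alternating (u : Vec3 n) : Set where
    field
      repeated : ∀ x y → u x x y ≡ false
      rotation : ∀ x y z → u x y z ≡ u y z x
      transposition : ∀ {x y z} → Distinct3 x y z → u y x z ≡ not (u x y z)

    rotation² : ∀ x y z → u x y z ≡ u z x y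
    rotation² x y z = ≡-trans (rotation x y z) (rotation y z x)

    transposition₂₃ : ∀ {x y z} → Distinct3 x y z → u x z y ≡ not (u x y z)
    transposition₂₃ {x} {y} {z} D = ≡-trans (rotation² x z y) (transposition D)

    degenerate : ∀ {x y z} → ¬ Distinct3 x y z → u x y z ≡ false
    degenerate {x} {y} {z} ¬D with x ≟ y | y ≟ z | x ≟ z
    ... | yes refl | _ | _ = repeated x z
    ... | no _ | yes refl | _ = ≡-trans (rotation x y y) (repeated y x)
    ... | no _ | no _ | yes refl = ≡-trans (rotation² x y x) (repeated x y)
    ... | no xy | no yz | no xz = ⊥-elim (¬D (xy , yz , xz))

    true⇒Distinct3 : ∀ {x y z} → u x y z ≡ true → Distinct3 x y z
    true⇒Distinct3 {x} {y} {z} ux≡true with distinct3? x y z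
    ... | yes D = D
    ... | no ¬D with () ← ≡-trans (sym (degenerate ¬D)) ux≡true

  Cocycle : Vec3 n → Set
  Cocycle u = ∀ {t x y z} → Distinct4 t x y z → u t x y xor u t x z xor u t y z xor u x y z ≡ false

  PointwiseTransitive : Vec3 n → Set
  PointwiseTransitive u =
    ∀ {t x y z} → Distinct4 t x y z → u t x y ≡ true → u t y z ≡ true → u t x z ≡ true

  In𝒰⇒Alternating : ∀ u → In𝒰 u → Alternating u
  In𝒰⇒Alternating _ (repeated , rotation , transposition , _) = record
    { repeated = repeated
    ; rotation = λ x y z → xor≡false⇒≡ (rotation x y z)
    ; transposition = λ D → xor≡true⇒≡not (transposition _ _ _ D)
    }

  In𝒰⇒Cocycle : ∀ u → In𝒰 u → Cocycle u
  In𝒰⇒Cocycle _ (_ , _ , _ , δu) = δu _ _ _ _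

  Alternating⇒In𝒰 : ∀ {u} → Alternating u → Cocycle u → In𝒰 u
  Alternating⇒In𝒰 {u} alt δu = repeated
    , (λ x y z → ≡⇒xor≡false (rotation x y z))
    , (λ x y z D → subst (λ v → u x y z xor v ≡ true) (sym (transposition D)) (xor-inverseʳ (u x y z)))
    , λ _ _ _ _ → δu
    where open Alternating alt

  Displays : Vec3 n → Fin n → Fin n → Fin n → Fin n → Set
  Displays u a b c d = u a b c ≡ u a b d × u a c d ≡ u b c d

  SomeDisplays : Vec3 n → Fin n → Fin n → Fin n → Fin n → Set
  SomeDisplays u a b c d = Displays u a b c d ⊎ Displays u a c b d ⊎ Displays u a d b c

  module _ {u : Vec3 n} (alt : Alternating u) where
    open Alternating alt

    cocycle-displays : Cocycle u → ∀ {a b c d} → Distinct4 a b c d →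
      u a b c ≡ u a b d → Displays u a b c d
    cocycle-displays δu {a} {b} {c} {d} D abc≡abd = abc≡abd , xor≡false⇒≡ (begin
      u a c d xor u b c d                             ≡⟨ xor-cancelˡ (u a b c) _ ⟨
      u a b c xor u a b c xor u a c d xor u b c d
        ≡⟨ cong (λ v → u a b c xor v xor u a c d xor u b c d) abc≡abd ⟩
      u a b c xor u a b d xor u a c d xor u b c d     ≡⟨ δu D ⟩
      false                                           ∎)
      where open ≡-Reasoning

    displays-swap₁₂ : ∀ {a b c d} → Distinct4 a b c d → Displays u a b c d → Displays u b a c d
    displays-swap₁₂ (ab , ac , ad , bc , bd , cd) (abc≡abd , acd≡bcd) =
      ≡-trans (transposition (ab , bc , ac))
        (≡-trans (cong not abc≡abd) (sym (transposition (ab , bd , ad))))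
      , sym acd≡bcd

    displays-swap₃₄ : ∀ {a b c d} → Distinct4 a b c d → Displays u a b c d → Displays u a b d c
    displays-swap₃₄ (ab , ac , ad , bc , bd , cd) (abc≡abd , acd≡bcd) =
      sym abc≡abd
      , ≡-trans (transposition₂₃ (ac , cd , ad))
          (≡-trans (cong not acd≡bcd) (sym (transposition₂₃ (bc , cd , bd))))

    displays-swap-pairs : ∀ {a b c d} → Displays u a b c d → Displays u c d a b
    displays-swap-pairs {a} {b} {c} {d} (abc≡abd , acd≡bcd) =
      ≡-trans (sym (rotation a c d)) (≡-trans acd≡bcd (rotation b c d))
      , ≡-trans (sym (rotation² a b c)) (≡-trans abc≡abd (rotation² a b d))

    someDisplays-symmetric : Symmetric4 (SomeDisplays u)
    someDisplays-symmetric = record { swap₁₂ = swap₁₂ ; swap₂₃ = swap₂₃ ; swap₃₄ = swap₃₄ }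
      where
      swap₁₂ : ∀ {a b c d} → Distinct4 a b c d → SomeDisplays u a b c d → SomeDisplays u b a c d
      swap₁₂ D (inj₁ s) = inj₁ (displays-swap₁₂ D s)
      swap₁₂ D (inj₂ (inj₁ s)) = inj₂ (inj₂ (displays-swap-pairs s))
      swap₁₂ D (inj₂ (inj₂ s)) = inj₂ (inj₁ (displays-swap-pairs s))
      swap₂₃ : ∀ {a b c d} → Distinct4 a b c d → SomeDisplays u a b c d → SomeDisplays u a c b d
      swap₂₃ D (inj₁ s) = inj₂ (inj₁ s)
      swap₂₃ D (inj₂ (inj₁ s)) = inj₁ s
      swap₂₃ D (inj₂ (inj₂ s)) =
        inj₂ (inj₂ (displays-swap₃₄ (Distinct4-swap₂₃ (Distinct4-swap₃₄ D)) s))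
      swap₃₄ : ∀ {a b c d} → Distinct4 a b c d → SomeDisplays u a b c d → SomeDisplays u a b d c
      swap₃₄ D (inj₁ s) = inj₁ (displays-swap₃₄ D s)
      swap₃₄ D (inj₂ (inj₁ s)) = inj₂ (inj₂ s)
      swap₃₄ D (inj₂ (inj₂ s)) = inj₂ (inj₁ s)

    someDisplays⇒transitive : ∀ {t x y z} → Distinct4 t x y z → SomeDisplays u t x y z →
      u t x y ≡ true → u t y z ≡ true → u t x z ≡ true
    someDisplays⇒transitive _ (inj₁ (txy≡txz , _)) txy tyz = ≡-trans (sym txy≡txz) txy
    someDisplays⇒transitive (tx , ty , tz , xy , xz , yz) (inj₂ (inj₁ (tyx≡tyz , _))) txy tyz
      with () ← ≡-trans (sym (≡-trans (transposition₂₃ (tx , xy , ty)) (cong not txy)))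
                  (≡-trans tyx≡tyz tyz)
    someDisplays⇒transitive (tx , ty , tz , xy , xz , yz) (inj₂ (inj₂ (tzx≡tzy , _))) txy tyz =
      not-injective (begin
        not (u _ _ _)  ≡⟨ transposition₂₃ (tx , xz , tz) ⟨
        u _ _ _        ≡⟨ tzx≡tzy ⟩
        u _ _ _        ≡⟨ transposition₂₃ (ty , yz , tz) ⟩
        not (u _ _ _)  ≡⟨ cong not tyz ⟩
        not true       ∎)
      where open ≡-Reasoning

    someDisplays⇒cocycle : ∀ {t x y z} → Distinct4 t x y z → SomeDisplays u t x y z →
      u t x y xor u t x z xor u t y z xor u x y z ≡ false
    someDisplays⇒cocycle {t} {x} {y} {z} _ (inj₁ (txy≡txz , tyz≡xyz))
      rewrite txy≡txz | tyz≡xyz = xor-aabb (u t x z) (u x y z)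
    someDisplays⇒cocycle {t} {x} {y} {z} (tx , ty , tz , xy , xz , yz) (inj₂ (inj₁ (tyx≡tyz , txz≡yxz)))
      rewrite transposition₂₃ (ty , ≢-sym xy , tx) | tyx≡tyz | txz≡yxz
            | transposition (≢-sym xy , xz , yz) = xor-not-crossed (u t y z) (u y x z)
    someDisplays⇒cocycle {t} {x} {y} {z} (tx , ty , tz , xy , xz , yz) (inj₂ (inj₂ (tzx≡tzy , txy≡zxy)))
      rewrite transposition₂₃ (tz , ≢-sym xz , tx) | tzx≡tzy | transposition₂₃ (tz , ≢-sym yz , ty)
            | rotation² x y z | sym txy≡zxy = xor-abba (u t x y) (not (u t z y))

-- Cyclic vectors

-- The cyclic order cut open at 0: first 0, then the other points ordered by u(0,·,·).
module BasedAtZero {m : ℕ} {u : Vec3 (suc m)} (alt : Alternating u) (δu : Cocycle u)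
  (u-transitive : PointwiseTransitive u) where
  open Alternating alt

  _≺_ : Fin (suc m) → Fin (suc m) → Bool
  zero ≺ zero = false
  zero ≺ suc _ = true
  suc i ≺ b = u zero (suc i) b

  ≺-zero : ∀ a → a ≺ zero ≡ false
  ≺-zero zero = refl
  ≺-zero (suc i) = ≡-trans (rotation² zero (suc i) zero) (repeated zero (suc i))

  ≺-irrefl : ∀ a → a ≺ a ≡ false
  ≺-irrefl zero = refl
  ≺-irrefl (suc i) = ≡-trans (rotation zero (suc i) (suc i)) (repeated (suc i) zero)

  ≺-flip : ∀ {a b} → a ≢ b → b ≺ a ≡ not (a ≺ b)
  ≺-flip {zero} {zero} a≢b = ⊥-elim (a≢b refl)
  ≺-flip {zero} {suc j} _ = ≺-zero (suc j)
  ≺-flip {suc i} {zero} _ = cong not (sym (≺-zero (suc i)))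
  ≺-flip {suc i} {suc j} i≢j = transposition₂₃ ((λ ()) , i≢j , λ ())

  ≺-true⇒≢ : ∀ {a b} → a ≺ b ≡ true → a ≢ b
  ≺-true⇒≢ {a} ab refl with () ← ≡-trans (sym (≺-irrefl a)) ab

  ≺-trans : ∀ {a b c} → a ≺ b ≡ true → b ≺ c ≡ true → a ≺ c ≡ true
  ≺-trans {b = b} {zero} _ bc with () ← ≡-trans (sym (≺-zero b)) bc
  ≺-trans {zero} {c = suc _} _ _ = refl
  ≺-trans {suc i} {zero} ab _ with () ← ≡-trans (sym (≺-zero (suc i))) ab
  ≺-trans {suc i} {suc j} {suc k} ij jk with suc i ≟ suc k
  ... | yes refl with () ← ≡-trans (sym jk) (≡-trans (≺-flip (≺-true⇒≢ ij)) (cong not ij))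
  ... | no i≢k = u-transitive ((λ ()) , (λ ()) , (λ ()) , ≺-true⇒≢ ij , i≢k , ≺-true⇒≢ jk) ij jk

  -- For a, b, c ≠ 0 this is the cocycle relation at t = 0.
  u≡orientation : ∀ {a b c} → Distinct3 a b c → u a b c ≡ (a ≺ b xor a ≺ c xor b ≺ c)
  u≡orientation {zero} {zero} (ab , _) = ⊥-elim (ab refl)
  u≡orientation {zero} {suc _} {zero} (_ , _ , ac) = ⊥-elim (ac refl)
  u≡orientation {suc _} {zero} {zero} (_ , bc , _) = ⊥-elim (bc refl)
  u≡orientation {zero} {suc j} {suc k} _ = sym (not-involutive _)
  u≡orientation {suc i} {zero} {suc k} (_ , _ , ik) = begin
    u (suc i) zero (suc k)                     ≡⟨ rotation (suc i) zero (suc k) ⟩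
    u zero (suc k) (suc i)                     ≡⟨ transposition₂₃ ((λ ()) , ik , λ ()) ⟩
    not (u zero (suc i) (suc k))               ≡⟨ xor-comm true _ ⟩
    u zero (suc i) (suc k) xor true            ≡⟨ cong (_xor (u zero (suc i) (suc k) xor true)) (≺-zero (suc i)) ⟨
    suc i ≺ zero xor (suc i ≺ suc k xor true)  ∎
    where open ≡-Reasoning
  u≡orientation {suc i} {suc j} {zero} _ = begin
    u (suc i) (suc j) zero                              ≡⟨ rotation² (suc i) (suc j) zero ⟩
    u zero (suc i) (suc j)                              ≡⟨ xor-identityʳ _ ⟨
    u zero (suc i) (suc j) xor false
      ≡⟨ cong₂ (λ p q → u zero (suc i) (suc j) xor p xor q) (≺-zero (suc i)) (≺-zero (suc j)) ⟨
    suc i ≺ suc j xor suc i ≺ zero xor suc j ≺ zero     ∎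
    where open ≡-Reasoning
  u≡orientation {suc i} {suc j} {suc k} (ij , jk , ik) =
    sym (xor₄≡false⇒≡ (u zero (suc i) (suc j)) (u zero (suc i) (suc k)) (u zero (suc j) (suc k))
      (δu ((λ ()) , (λ ()) , (λ ()) , ij , ik , jk)))

  open BoolOrder _≟_ _≺_ ≺-irrefl ≺-flip (λ {a} {b} {c} → ≺-trans {a} {b} {c})

  u≡true⇔cyclically : ∀ {a b c} → Distinct3 a b c → u a b c ≡ true ⇔ Cyclically _<_ a b c
  u≡true⇔cyclically {a} {b} {c} D@(ab , _ , ac) =
    subst (λ v → v ≡ true ⇔ Cyclically _<_ a b c) (sym (u≡orientation D))
      (orientation≡true⇔cyclically ab ac)

  enumeration : LinearOrdering (suc m)
  enumeration = sort (allFin (suc m)) , sort-↭ (allFin (suc m))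

  enumeration-sorted : AllPairs _<_ (proj₁ enumeration)
  enumeration-sorted = sort-strictlySorted (allFin⁺ (suc m))

  ∈-enumeration : ∀ x → x ∈ proj₁ enumeration
  ∈-enumeration x = ∈-resp-↭ (↭-sym (sort-↭ (allFin (suc m)))) (∈-allFin x)

  open StrictlySorted (λ {a} → <-irrefl {a}) (λ {a} {b} {c} → ≺-trans {a} {b} {c})

  enumeration-isUC : IsUC enumeration u
  enumeration-isUC x y z = mk⇔
    (λ uxyz≡true → let D = true⇒Distinct3 uxyz≡true in D
      , cyclically⇒rotation⊇ enumeration-sorted (∈-enumeration x) (∈-enumeration y) (∈-enumeration z)
          (Equivalence.to (u≡true⇔cyclically D) uxyz≡true))
    λ (D , r , τ) → Equivalence.from (u≡true⇔cyclically D) (rotation⊇⇒cyclically r enumeration-sorted τ)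

alternating-cocycle⇒cyclic : ∀ {n} {u : Vec3 n} →
  Alternating u → Cocycle u → PointwiseTransitive u → Cyclic u
alternating-cocycle⇒cyclic {zero} _ _ _ = ([] , refl) , λ ()
alternating-cocycle⇒cyclic {suc m} alt δu u-transitive = enumeration , enumeration-isUC
  where open BasedAtZero alt δu u-transitive

-- The two descriptions of U(Q)

module _ {n : ℕ} {Q : List (Quartet n)} {u : Vec3 n} where

  InU⇒displays : InU Q u → ∀ {a b c d} → (a , b , c , d) ∈Q Q → Displays u a b c d
  InU⇒displays (u∈𝒰 , split) q∈Q@(D , _) =
    cocycle-displays (In𝒰⇒Alternating u u∈𝒰) (In𝒰⇒Cocycle u u∈𝒰) D (xor≡false⇒≡ (split _ _ _ _ q∈Q))

  InU⇒InRHS : InU Q u → InRHS Q u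
  InU⇒InRHS uU@(u∈𝒰 , _) = (λ _ _ _ → degenerate)
    , (λ a b c (ab , bc , ac) → rotation a b c , ≡-trans (rotation b c a) (transposition (ac , ≢-sym bc , ab)))
    , (λ _ _ _ _ → InU⇒displays uU)
    where open Alternating (In𝒰⇒Alternating u u∈𝒰)

  InRHS⇒Alternating : InRHS Q u → Alternating u
  InRHS⇒Alternating (vanishes , cyclic-flip , _) = record
    { repeated = λ x y → vanishes x x y (λ D → proj₁ D refl)
    ; rotation = rotation
    ; transposition = transposition
    }
    where
    rotation : ∀ x y z → u x y z ≡ u y z x
    rotation x y z with distinct3? x y z
    ... | yes D = proj₁ (cyclic-flip x y z D)
    ... | no ¬D = ≡-trans (vanishes x y z ¬D)
      (sym (vanishes y z x λ (yz , zx , yx) → ¬D (≢-sym yx , yz , ≢-sym zx)))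
    transposition : ∀ {x y z} → Distinct3 x y z → u y x z ≡ not (u x y z)
    transposition {x} {y} {z} D@(xy , yz , xz) with cyclic-flip y x z (≢-sym xy , xz , yz)
    ... | yxz≡xzy , xzy≡¬yzx =
      ≡-trans yxz≡xzy (≡-trans xzy≡¬yzx (cong not (sym (proj₁ (cyclic-flip x y z D)))))

  InRHS⇒InU : Dense Q → InRHS Q u → InU Q u
  InRHS⇒InU dense rhs@(_ , _ , displays) = Alternating⇒In𝒰 alt δu
    , λ a b c d q∈Q → ≡⇒xor≡false (proj₁ (displays a b c d q∈Q))
    where
    alt = InRHS⇒Alternating rhs
    δu : Cocycle u
    δu D = someDisplays⇒cocycle alt D
      (dense⇒everywhere dense (someDisplays-symmetric alt) (λ q∈Q → inj₁ (displays _ _ _ _ q∈Q)) D)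

  InU⇒PointwiseTransitive : Dense Q → InU Q u → PointwiseTransitive u
  InU⇒PointwiseTransitive dense uU@(u∈𝒰 , _) D = someDisplays⇒transitive alt D
    (dense⇒everywhere dense (someDisplays-symmetric alt) (λ q∈Q → inj₁ (InU⇒displays uU q∈Q)) D)
    where alt = In𝒰⇒Alternating u u∈𝒰

theorem4 : (n : ℕ) (Q : List (Quartet n)) → Dense Q →
    (∀ (u : Vec3 n) → InU Q u → Cyclic u)
    × (∀ (u : Vec3 n) → InU Q u ⇔ InRHS Q u)
theorem4 n Q dense =
  (λ u uU@(u∈𝒰 , _) → alternating-cocycle⇒cyclic (In𝒰⇒Alternating u u∈𝒰) (In𝒰⇒Cocycle u u∈𝒰)
    (InU⇒PointwiseTransitive dense uU))
  , λ u → mk⇔ InU⇒InRHS (InRHS⇒InU dense)
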